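{- Fix $k\in\mathbb{N}$ and let $a_n=\Gamma(k,n)$ for $n\ge1$. (1) If $k$ is odd, then $(a_n)_{n\ge1}$ has period $k$, and among $a_1,\ldots,a_k$ the number of $1$'s is one more than the number of $2$'s. (2) If $k$ is even, then $(a_n)_{n\ge1}$ has period $2k$, and among $a_1,\ldots,a_{2k}$ the number of $1$'s is two more than the number of $2$'s.
   Context: $\mathbb{N}$ denotes the positive integers. For coprime $a,b\in\mathbb{N}$, consider the equations (E1) $ax+by=\frac{(a-1)(b-1)}{2}$ and (E2) $ax+by+1=\frac{(a-1)(b-1)}{2}$. We say the pair $(a,b)$ uses (E1) if (E1) has a solution in nonnegative integers $x,y$. For arbitrary $a,b\in\mathbb{N}$ with $d=\gcd(a,b)$, define $\Gamma(a,b)=1$ if the coprime pair $(a/d,b/d)$ uses (E1), and $\Gamma(a,b)=2$ otherwise. The period of a sequence $(a_n)_{n\ge1}$ is the smallest positive integer $T$ (if any) such that $a_n=a_{n+T}$ for all $n\ge1$. -}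

module Defs where

open import Data.Nat using (ℕ; zero; suc; _+_; _*_; _∸_; _≤_; _<_; _≟_; z≤n; s≤s)
open import Data.Nat.Properties
open import Data.Nat.DivMod using (_/_)
open import Data.Nat.GCD using (gcd)
open import Data.Fin using (Fin; toℕ; fromℕ<)
open import Data.Fin.Properties using (any?; toℕ-fromℕ<)
open import Data.Product using (Σ; ∃; _,_; _×_)
open import Data.Bool using (if_then_else_)
open import Data.List using (List; length; filter; applyUpTo)
open import Relation.Nullary using (Dec; yes; no; does)
open import Relation.Binary.PropositionalEquality using (_≡_; refl; sym; trans; cong; cong₂)

-- The right-hand side (a-1)(b-1)/2 of (E1).  For coprime positive a, b this
-- is always an integer (not both a, b even), so floor division is exact.
half : ℕ → ℕ → ℕ
half a b = ((a ∸ 1) * (b ∸ 1)) / 2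

UsesE1 : ℕ → ℕ → Set
UsesE1 a b = ∃ λ x → ∃ λ y → a * x + b * y ≡ half a b

private
  bounded : ℕ → ℕ → ℕ → Set
  bounded a b c = ∃ λ (i : Fin (suc c)) → ∃ λ (j : Fin (suc c)) → a * toℕ i + b * toℕ j ≡ c

  bounded? : ∀ a b c → Dec (bounded a b c)
  bounded? a b c = any? (λ i → any? (λ j → a * toℕ i + b * toℕ j ≟ c))

  le-mul : ∀ a x → 0 < a → x ≤ a * x
  le-mul (suc a) x _ = m≤m+n x (a * x)

  boundX : ∀ a b x y c → a * x + b * y ≡ c → 0 < a → x < suc c
  boundX a b x y c eq p = s≤s (≤-trans (le-mul a x p)
    (≤-trans (m≤m+n (a * x) (b * y)) (≤-reflexive eq)))

  boundY : ∀ a b x y c → a * x + b * y ≡ c → 0 < b → y < suc c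
  boundY a b x y c eq p = s≤s (≤-trans (le-mul b y p)
    (≤-trans (m≤n+m (b * y) (a * x)) (≤-reflexive eq)))

  fromBounded : ∀ a b → bounded a b (half a b) → UsesE1 a b
  fromBounded a b (i , j , eq) = toℕ i , toℕ j , eq

  toBounded : ∀ a b → 0 < a → 0 < b → UsesE1 a b → bounded a b (half a b)
  toBounded a b pa pb (x , y , eq) =
    fromℕ< (boundX a b x y _ eq pa) , fromℕ< (boundY a b x y _ eq pb) ,
    trans (cong₂ _+_ (cong (a *_) (toℕ-fromℕ< (boundX a b x y _ eq pa)))
                     (cong (b *_) (toℕ-fromℕ< (boundY a b x y _ eq pb)))) eq

usesE1? : ∀ a b → Dec (UsesE1 a b)
usesE1? zero b = yes (0 , 0 , *-zeroʳ b)
usesE1? (suc a) zero = yes (0 , 0 , trans (+-identityʳ (suc a * 0)) (trans (*-zeroʳ (suc a)) (sym (cong (_/ 2) (*-zeroʳ a)))))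
usesE1? (suc a) (suc b) with bounded? (suc a) (suc b) (half (suc a) (suc b))
... | yes p = yes (fromBounded (suc a) (suc b) p)
... | no ¬p = no (λ u → ¬p (toBounded (suc a) (suc b) (s≤s z≤n) (s≤s z≤n) u))

-- Γ(a,b): with d = gcd a b, Γ = 1 if (a/d, b/d) uses (E1), else 2.
-- (For a = b = 0, gcd is 0; we set d-division to be irrelevant there by
--  convention; only a, b ≥ 1 are used in the theorem.)
Γ : ℕ → ℕ → ℕ
Γ a b with gcd a b
... | zero = 2
... | suc d = if does (usesE1? (a / suc d) (b / suc d)) then 1 else 2

IsPeriod : (ℕ → ℕ) → ℕ → Set
IsPeriod f T = 0 < T × (∀ n → 1 ≤ n → f n ≡ f (n + T))

HasPeriod : (ℕ → ℕ) → ℕ → Set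
HasPeriod f T = IsPeriod f T × (∀ T′ → IsPeriod f T′ → T ≤ T′)

countVal : (ℕ → ℕ) → ℕ → ℕ → ℕ
countVal f v m = length (filter (λ i → f i ≟ v) (applyUpTo suc m))

-- For coprime a, b let H = (a − 1)(b − 1)/2 and let y < a solve b·y ≡ H (mod a).  Then (a, b)
-- uses (E1) iff b·y ≤ H: if also b·y = H + a(z + 1) and H = a·x + b·y′, then a divides
-- y − y′ with 0 < y − y′ < a.  A solution of (E1) at y forces 2y ≤ a − 1 (indeed 2y < a − 1
-- when a ≥ 2), while b·y > H forces 2y ≥ a.  Replacing b by b + c·a with c(a − 1) even keeps y
-- and adds c·a·y to b·y and a·c(a − 1)/2 to H, and by these bounds b·y ≤ H is unaffected:
-- Γ(k, ·) has period 2k, and period k when k is odd.  Replacing b by 2a − b turns y into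
-- a − 1 − y, and the bounds forbid both pairs from falling in the same case, so
-- Γ(k, n) ≠ Γ(k, 2k − n) for 0 < n < 2k, n ≠ k.  As Γ(k, k·m) = 1, a period T < 2k with T ≠ k
-- would give Γ(k, T) = 1 = Γ(k, 2k − T); for even k, T = k fails as Γ(k, 1) = 1 ≠ 2 = Γ(k, k + 1).
-- Finally n ↦ 2k − n, or n ↦ k − n for odd k, pairs the 1's with the 2's, leaving n = k (and
-- n = 2k when counting up to 2k), where Γ = 1.

module Submission where

open import Defs
open import Data.Nat
  using (ℕ; zero; suc; _+_; _*_; _∸_; _≤_; _<_; _≟_; z≤n; s≤s; z<s; s<s; pred; _≤?_; _≡ᵇ_; >-nonZero; ≢-nonZero)
open import Data.Nat.Properties
open import Data.Nat.Tactic.RingSolver using (solve-∀)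
open import Data.Nat.Divisibility using (_∣_; divides; 0∣⇒≡0; ∣⇒≤; ∣m+n∣m⇒∣n; n∣m*n; ∣-trans)
open import Data.Nat.Coprimality as Coprimality
  using (Coprime; coprime-divisor; coprime-Bézout; coprime-+; 1-coprimeTo; coprime⇒gcd≡1; coprime-/gcd)
open import Data.Nat.GCD
  using (module Bézout; gcd; c*gcd[m,n]≡gcd[cm,cn]; gcd[m,n]≢0; gcd[m,n]∣m; gcd[m,n]∣n)
open import Data.Nat.DivMod using (_/_; _%_; m≡m%n+[m/n]*n; m%n<n; m*n/n≡m; m*[n/m]≡n)
open import Data.List using (length; filter; applyUpTo)
open import Data.Product using (∃; ∃₂; _×_; _,_; proj₁; proj₂)
open import Data.Sum using (_⊎_; inj₁; inj₂)
open import Data.Empty using (⊥; ⊥-elim)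
open import Data.Bool using (if_then_else_; true; false)
open import Function using (_∘_; _$_; _⇔_; mk⇔; Equivalence)
open import Relation.Nullary using (¬_; yes; no; does)
open import Relation.Binary.PropositionalEquality

-- b·y + a·P = H + a·Q, doubled to avoid the division in `half`: for coprime a, b the
-- product (a − 1)(b − 1) is even (2*half≡a'*b').
record Solution (a b y P Q : ℕ) : Set where
  constructor solution
  field equation : 2 * (b * y) + 2 * (a * P) ≡ pred a * pred b + 2 * (a * Q)

record E1At (a b y : ℕ) : Set where
  constructor e1At
  field
    x        : ℕ
    equation : 2 * (a * x) + 2 * (b * y) ≡ pred a * pred b

record AboveAt (a b y : ℕ) : Set where
  constructor aboveAt
  field
    z        : ℕ
    equation : 2 * (b * y) ≡ pred a * pred b + 2 * (a * suc z)

Solution⇒E1At : ∀ {a b y P Q} → Solution a b y P Q → Q ≤ P → E1At a b y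
Solution⇒E1At {a} {b} {y} {Q = Q} (solution s) Q≤P with m≤n⇒∃[o]m+o≡n Q≤P
... | x , refl = e1At x $ +-cancelʳ-≡ (2 * (a * Q)) _ _ (trans (regroup a b y Q x) s)
  where
  regroup : ∀ a b y Q x → 2 * (a * x) + 2 * (b * y) + 2 * (a * Q) ≡ 2 * (b * y) + 2 * (a * (Q + x))
  regroup = solve-∀

Solution⇒AboveAt : ∀ {a b y P Q} → Solution a b y P Q → P < Q → AboveAt a b y
Solution⇒AboveAt {a} {b} {y} {P} (solution s) P<Q with m≤n⇒∃[o]m+o≡n P<Q
... | z , refl = aboveAt z $ +-cancelʳ-≡ (2 * (a * P)) _ _ (trans s (regroup a (pred a * pred b) P z))
  where
  regroup : ∀ a h P z → h + 2 * (a * suc (P + z)) ≡ h + 2 * (a * suc z) + 2 * (a * P)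
  regroup = solve-∀

2*[m*n]≡m*[2*n] : ∀ m n → 2 * (m * n) ≡ m * (2 * n)
2*[m*n]≡m*[2*n] = solve-∀

E1At⇒b*2y≤a'*b' : ∀ {a' b y} → E1At (suc a') b y → b * (2 * y) ≤ a' * pred b
E1At⇒b*2y≤a'*b' {a'} {b} {y} (e1At x eq) = begin
  b * (2 * y)                       ≡⟨ 2*[m*n]≡m*[2*n] b y ⟨
  2 * (b * y)                       ≤⟨ m≤n+m (2 * (b * y)) (2 * (suc a' * x)) ⟩
  2 * (suc a' * x) + 2 * (b * y)    ≡⟨ eq ⟩
  a' * pred b                       ∎
  where open ≤-Reasoning

E1At⇒2y≤a' : ∀ {a' b' y} → E1At (suc a') (suc b') y → 2 * y ≤ a'
E1At⇒2y≤a' {a'} {b'} {y} rep = *-cancelˡ-≤ (suc b') (begin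
  suc b' * (2 * y)   ≤⟨ E1At⇒b*2y≤a'*b' rep ⟩
  a' * b'            ≤⟨ *-monoʳ-≤ a' (n≤1+n b') ⟩
  a' * suc b'        ≡⟨ *-comm a' (suc b') ⟩
  suc b' * a'        ∎)
  where open ≤-Reasoning

E1At⇒2y<a' : ∀ {a' b' y} → 1 ≤ a' → E1At (suc a') (suc b') y → 2 * y < a'
E1At⇒2y<a' {a'} {b'} {y} 1≤a' rep = *-cancelˡ-< (suc b') (2 * y) a' (begin-strict
  suc b' * (2 * y)   ≤⟨ E1At⇒b*2y≤a'*b' rep ⟩
  a' * b'            <⟨ m<n+m (a' * b') 1≤a' ⟩
  a' + a' * b'       ≡⟨ *-suc a' b' ⟨
  a' * suc b'        ≡⟨ *-comm a' (suc b') ⟩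
  suc b' * a'        ∎)
  where open ≤-Reasoning

AboveAt⇒a'<2y : ∀ {a' b' y} → AboveAt (suc a') (suc b') y → a' < 2 * y
AboveAt⇒a'<2y {a'} {b'} {y} (aboveAt z eq) = *-cancelˡ-< (suc b') a' (2 * y) (begin-strict
  suc b' * a'                  ≡⟨ cong (a' +_) (*-comm b' a') ⟩
  a' + a' * b'                 <⟨ +-monoˡ-< (a' * b') a'<2az ⟩
  2 * (suc a' * suc z) + a' * b' ≡⟨ +-comm _ (a' * b') ⟩
  a' * b' + 2 * (suc a' * suc z) ≡⟨ eq ⟨
  2 * (suc b' * y)             ≡⟨ 2*[m*n]≡m*[2*n] (suc b') y ⟩
  suc b' * (2 * y)             ∎)
  where
  open ≤-Reasoning
  a'<2az : a' < 2 * (suc a' * suc z)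
  a'<2az = ≤-trans (m≤m*n (suc a') (suc z)) (m≤n*m _ 2)

E1At×AboveAt⇒⊥ : ∀ {a b y₁ y} → Coprime a b → y < a → E1At a b y₁ → AboveAt a b y → ⊥
E1At×AboveAt⇒⊥ {suc a'} {b} {y₁} {y} cop y<a (e1At x rep) (aboveAt z non) = <⇒≱ y<a a≤y
  where
  a : ℕ
  a = suc a'
  step : b * y ≡ a * suc (z + x) + b * y₁
  step = *-cancelˡ-≡ _ _ 2 (begin
    2 * (b * y)                                ≡⟨ non ⟩
    a' * pred b + 2 * (a * suc z)              ≡⟨ cong (_+ 2 * (a * suc z)) rep ⟨
    2 * (a * x) + 2 * (b * y₁) + 2 * (a * suc z) ≡⟨ regroup a b x y₁ z ⟩
    2 * (a * suc (z + x) + b * y₁)             ∎)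
    where
    open ≡-Reasoning
    regroup : ∀ a b x y₁ z →
      2 * (a * x) + 2 * (b * y₁) + 2 * (a * suc z) ≡ 2 * (a * suc (z + x) + b * y₁)
    regroup = solve-∀
  y₁<y : y₁ < y
  y₁<y = *-cancelˡ-< b y₁ y (subst (b * y₁ <_) (sym step) (m<n+m (b * y₁) z<s))
  a≤y : a ≤ y
  a≤y with m≤n⇒∃[o]m+o≡n y₁<y
  ... | e , refl = ≤-trans (∣⇒≤ a∣1+e) (s≤s (m≤n+m e y₁))
    where
    b*[1+e]≡[1+z+x]*a : b * suc e ≡ suc (z + x) * a
    b*[1+e]≡[1+z+x]*a = +-cancelˡ-≡ (b * y₁) _ _ (begin
      b * y₁ + b * suc e            ≡⟨ *-distribˡ-+ b y₁ (suc e) ⟨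
      b * (y₁ + suc e)              ≡⟨ cong (b *_) (+-suc y₁ e) ⟩
      b * y                         ≡⟨ step ⟩
      a * suc (z + x) + b * y₁      ≡⟨ +-comm _ (b * y₁) ⟩
      b * y₁ + a * suc (z + x)      ≡⟨ cong (b * y₁ +_) (*-comm a (suc (z + x))) ⟩
      b * y₁ + suc (z + x) * a      ∎)
      where open ≡-Reasoning
    a∣1+e : a ∣ suc e
    a∣1+e = coprime-divisor cop (divides (suc (z + x)) b*[1+e]≡[1+z+x]*a)

even⊎odd : ∀ n → (∃ λ h → n ≡ 2 * h) ⊎ (∃ λ h → n ≡ suc (2 * h))
even⊎odd zero = inj₁ (0 , refl)
even⊎odd (suc zero) = inj₂ (0 , refl)
even⊎odd (suc (suc n)) with even⊎odd n
... | inj₁ (h , refl) = inj₁ (suc h , cong suc (sym (+-suc h (h + 0))))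
... | inj₂ (h , refl) = inj₂ (suc h , cong (suc ∘ suc) (sym (+-suc h (h + 0))))

2*[n/2]≡n : ∀ {n} m → n ≡ m * 2 → 2 * (n / 2) ≡ n
2*[n/2]≡n m refl = trans (cong (2 *_) (m*n/n≡m m 2)) (*-comm 2 m)

2*half≡a'*b' : ∀ {a' b'} → Coprime (suc a') (suc b') → 2 * half (suc a') (suc b') ≡ a' * b'
2*half≡a'*b' {a'} {b'} cop with even⊎odd a' | even⊎odd b'
... | inj₁ (h , refl) | _               = 2*[n/2]≡n (h * b') (regroup h b')
  where regroup : ∀ h b' → 2 * h * b' ≡ h * b' * 2
        regroup = solve-∀
... | inj₂ _          | inj₁ (g , refl) = 2*[n/2]≡n (a' * g) (regroup a' g)
  where regroup : ∀ a' g → a' * (2 * g) ≡ a' * g * 2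
        regroup = solve-∀
... | inj₂ (h , refl) | inj₂ (g , refl) with cop (2∣2+2n h , 2∣2+2n g)
  where 2∣2+2n : ∀ n → 2 ∣ suc (suc (2 * n))
        2∣2+2n n = divides (suc n) (regroup n)
          where regroup : ∀ n → suc (suc (2 * n)) ≡ suc n * 2
                regroup = solve-∀
... | ()

Congruence : ℕ → ℕ → ℕ → ℕ → Set
Congruence a b m y = ∃₂ λ P Q → b * y + a * P ≡ m + a * Q

Congruence-% : ∀ {a' b m Y} → Congruence (suc a') b m Y → Congruence (suc a') b m (Y % suc a')
Congruence-% {a'} {b} {m} {Y} (P , Q , eq) = P + b * (Y / a) , Q , (begin
  b * (Y % a) + a * (P + b * (Y / a))   ≡⟨ regroup a b (Y % a) (Y / a) P ⟩
  b * (Y % a + (Y / a) * a) + a * P     ≡⟨ cong (λ t → b * t + a * P) (m≡m%n+[m/n]*n Y a) ⟨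
  b * Y + a * P                         ≡⟨ eq ⟩
  m + a * Q                             ∎)
  where
  open ≡-Reasoning
  a : ℕ
  a = suc a'
  regroup : ∀ a b r q P → b * r + a * (P + b * q) ≡ b * (r + q * a) + a * P
  regroup = solve-∀

Congruence-Bézout : ∀ {a' b} → Coprime (suc a') b → ∀ m → ∃ (Congruence (suc a') b m)
Congruence-Bézout {a'} {b} cop m with coprime-Bézout cop
... | Bézout.-+ x y eq = y * m , 0 , x * m , (begin
      b * (y * m) + a * 0      ≡⟨ regroup₁ a b y m ⟩
      (y * b) * m              ≡⟨ cong (_* m) eq ⟨
      (1 + x * a) * m          ≡⟨ regroup₂ a x m ⟩
      m + a * (x * m)          ∎)
  where
  open ≡-Reasoning
  a : ℕ
  a = suc a'
  regroup₁ : ∀ a b y m → b * (y * m) + a * 0 ≡ (y * b) * m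
  regroup₁ = solve-∀
  regroup₂ : ∀ a x m → (1 + x * a) * m ≡ m + a * (x * m)
  regroup₂ = solve-∀
... | Bézout.+- x y eq = a' * (y * m) , m , a' * (x * m) , (begin
      b * (a' * (y * m)) + a * m    ≡⟨ regroup₁ a' b y m ⟩
      a' * ((1 + y * b) * m) + m    ≡⟨ cong (λ t → a' * (t * m) + m) eq ⟩
      a' * ((x * a) * m) + m        ≡⟨ regroup₂ a' x m ⟩
      m + a * (a' * (x * m))        ∎)
  where
  open ≡-Reasoning
  a : ℕ
  a = suc a'
  regroup₁ : ∀ a' b y m → b * (a' * (y * m)) + suc a' * m ≡ a' * ((1 + y * b) * m) + m
  regroup₁ = solve-∀
  regroup₂ : ∀ a' x m → a' * ((x * suc a') * m) + m ≡ m + suc a' * (a' * (x * m))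
  regroup₂ = solve-∀

congruence-solvable : ∀ {a' b} → Coprime (suc a') b → ∀ m → ∃ λ y → y < suc a' × Congruence (suc a') b m y
congruence-solvable {a'} {b} cop m with Congruence-Bézout cop m
... | Y , c = Y % suc a' , m%n<n Y (suc a') , Congruence-% {a'} {b} {m} {Y} c

Congruence⇒Solution : ∀ {a' b' y} → Coprime (suc a') (suc b') →
  Congruence (suc a') (suc b') (half (suc a') (suc b')) y → ∃₂ (Solution (suc a') (suc b') y)
Congruence⇒Solution {a'} {b'} {y} cop (P , Q , eq) = P , Q , solution (begin
  2 * (b * y) + 2 * (a * P)  ≡⟨ *-distribˡ-+ 2 (b * y) (a * P) ⟨
  2 * (b * y + a * P)        ≡⟨ cong (2 *_) eq ⟩
  2 * (half a b + a * Q)     ≡⟨ *-distribˡ-+ 2 (half a b) (a * Q) ⟩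
  2 * half a b + 2 * (a * Q) ≡⟨ cong (_+ 2 * (a * Q)) (2*half≡a'*b' cop) ⟩
  a' * b' + 2 * (a * Q)      ∎)
  where
  open ≡-Reasoning
  a b : ℕ
  a = suc a'
  b = suc b'

solution-exists : ∀ {a' b'} → Coprime (suc a') (suc b') →
  ∃ λ y → y < suc a' × ∃₂ (Solution (suc a') (suc b') y)
solution-exists {a'} {b'} cop =
  let y , y<a , c = congruence-solvable cop (half (suc a') (suc b'))
  in y , y<a , Congruence⇒Solution cop c

E1At⇔UsesE1 : ∀ {a' b'} → Coprime (suc a') (suc b') → ∃ (E1At (suc a') (suc b')) ⇔ UsesE1 (suc a') (suc b')
E1At⇔UsesE1 {a'} {b'} cop = mk⇔ to from
  where
  open ≡-Reasoning
  a b : ℕ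
  a = suc a'
  b = suc b'
  to : ∃ (E1At a b) → UsesE1 a b
  to (y , e1At x eq) = x , y , *-cancelˡ-≡ _ _ 2 (begin
    2 * (a * x + b * y)          ≡⟨ *-distribˡ-+ 2 (a * x) (b * y) ⟩
    2 * (a * x) + 2 * (b * y)    ≡⟨ eq ⟩
    a' * b'                      ≡⟨ 2*half≡a'*b' cop ⟨
    2 * half a b                 ∎)
  from : UsesE1 a b → ∃ (E1At a b)
  from (x , y , eq) = y , e1At x (begin
    2 * (a * x) + 2 * (b * y)    ≡⟨ *-distribˡ-+ 2 (a * x) (b * y) ⟨
    2 * (a * x + b * y)          ≡⟨ cong (2 *_) eq ⟩
    2 * half a b                 ≡⟨ 2*half≡a'*b' cop ⟩
    a' * b'                      ∎)

-- Opaque because unfolding the bounded search of usesE1? during unification is prohibitively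
-- expensive.
opaque
  Γᶜ : ℕ → ℕ → ℕ
  Γᶜ a b = if does (usesE1? a b) then 1 else 2

  Γᶜ≡1 : ∀ {a b} → UsesE1 a b → Γᶜ a b ≡ 1
  Γᶜ≡1 {a} {b} u with usesE1? a b
  ... | yes _ = refl
  ... | no ¬u = ⊥-elim (¬u u)

  Γᶜ≡2 : ∀ {a b} → ¬ UsesE1 a b → Γᶜ a b ≡ 2
  Γᶜ≡2 {a} {b} ¬u with usesE1? a b
  ... | yes u = ⊥-elim (¬u u)
  ... | no _ = refl

Solution⇒Γᶜ≡1 : ∀ {a' b' y P Q} → Coprime (suc a') (suc b') →
  Solution (suc a') (suc b') y P Q → Q ≤ P → Γᶜ (suc a') (suc b') ≡ 1
Solution⇒Γᶜ≡1 {a'} {b'} {y} cop s Q≤P =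
  Γᶜ≡1 {suc a'} {suc b'} (Equivalence.to (E1At⇔UsesE1 cop) (y , Solution⇒E1At s Q≤P))

Solution⇒Γᶜ≡2 : ∀ {a' b' y P Q} → Coprime (suc a') (suc b') → y < suc a' →
  Solution (suc a') (suc b') y P Q → P < Q → Γᶜ (suc a') (suc b') ≡ 2
Solution⇒Γᶜ≡2 {a'} {b'} cop y<a s P<Q = Γᶜ≡2 {suc a'} {suc b'} λ u →
  let (_ , rep) = Equivalence.from (E1At⇔UsesE1 cop) u
  in E1At×AboveAt⇒⊥ cop y<a rep (Solution⇒AboveAt s P<Q)

Coprime-+-* : ∀ {a b} c → Coprime a b → Coprime a (b + c * a)
Coprime-+-* {a} {b} c cop {i} (i∣a , i∣b+ca) =
  cop (i∣a , ∣m+n∣m⇒∣n (subst (i ∣_) (+-comm b (c * a)) i∣b+ca) (∣-trans i∣a (n∣m*n c)))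

Solution-+-* : ∀ {a' b' y P Q} c t → 2 * t ≡ c * a' →
  Solution (suc a') (suc b') y P Q → Solution (suc a') (suc b' + c * suc a') y (P + t) (Q + c * y)
Solution-+-* {a'} {b'} {y} {P} {Q} c t 2t≡ca' (solution s) = solution (begin
  2 * ((suc b' + c * a) * y) + 2 * (a * (P + t))            ≡⟨ regroup₁ a b' y P t c ⟩
  (2 * (suc b' * y) + 2 * (a * P)) + (2 * (a * (c * y)) + a * (2 * t))
                                                            ≡⟨ cong₂ (λ u v → u + (2 * (a * (c * y)) + a * v)) s 2t≡ca' ⟩
  (a' * b' + 2 * (a * Q)) + (2 * (a * (c * y)) + a * (c * a')) ≡⟨ regroup₂ a' b' Q y c ⟩
  a' * (b' + c * a) + 2 * (a * (Q + c * y))                  ∎)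
  where
  open ≡-Reasoning
  a : ℕ
  a = suc a'
  regroup₁ : ∀ a b' y P t c → 2 * ((suc b' + c * a) * y) + 2 * (a * (P + t))
           ≡ (2 * (suc b' * y) + 2 * (a * P)) + (2 * (a * (c * y)) + a * (2 * t))
  regroup₁ = solve-∀
  regroup₂ : ∀ a' b' Q y c → (a' * b' + 2 * (suc a' * Q)) + (2 * (suc a' * (c * y)) + suc a' * (c * a'))
           ≡ a' * (b' + c * suc a') + 2 * (suc a' * (Q + c * y))
  regroup₂ = solve-∀

Γᶜ-+-* : ∀ {a' b'} c t → 1 ≤ c → 2 * t ≡ c * a' → Coprime (suc a') (suc b') →
  Γᶜ (suc a') (suc b' + c * suc a') ≡ Γᶜ (suc a') (suc b')
Γᶜ-+-* {a'} {b'} c t 1≤c 2t≡ca' cop =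
  let y , y<a , P , Q , s = solution-exists cop in compare y<a s (≤-<-connex Q P)
  where
  cop' : Coprime (suc a') (suc b' + c * suc a')
  cop' = Coprime-+-* c cop
  compare : ∀ {y P Q} → y < suc a' → Solution (suc a') (suc b') y P Q → Q ≤ P ⊎ P < Q →
            Γᶜ (suc a') (suc b' + c * suc a') ≡ Γᶜ (suc a') (suc b')
  compare {y} y<a s (inj₁ Q≤P) =
    trans (Solution⇒Γᶜ≡1 cop' (Solution-+-* c t 2t≡ca' s) (+-mono-≤ Q≤P cy≤t))
          (sym (Solution⇒Γᶜ≡1 cop s Q≤P))
    where
    cy≤t : c * y ≤ t
    cy≤t = *-cancelˡ-≤ 2 (begin
      2 * (c * y)   ≡⟨ 2*[m*n]≡m*[2*n] c y ⟩
      c * (2 * y)   ≤⟨ *-monoʳ-≤ c (E1At⇒2y≤a' (Solution⇒E1At s Q≤P)) ⟩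
      c * a'        ≡⟨ 2t≡ca' ⟨
      2 * t         ∎)
      where open ≤-Reasoning
  compare {y} y<a s (inj₂ P<Q) =
    trans (Solution⇒Γᶜ≡2 cop' y<a (Solution-+-* c t 2t≡ca' s) (+-mono-< P<Q t<cy))
          (sym (Solution⇒Γᶜ≡2 cop y<a s P<Q))
    where
    t<cy : t < c * y
    t<cy = *-cancelˡ-< 2 t (c * y) (begin-strict
      2 * t         ≡⟨ 2t≡ca' ⟩
      c * a'        <⟨ *-monoʳ-< c {{>-nonZero 1≤c}} (AboveAt⇒a'<2y (Solution⇒AboveAt s P<Q)) ⟩
      c * (2 * y)   ≡⟨ 2*[m*n]≡m*[2*n] c y ⟨
      2 * (c * y)   ∎)
      where open ≤-Reasoning

-- With c' = 2a' − b' the equation is not a semiring identity; moving both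
-- occurrences of b' + c' to opposite sides of the same sum makes it one.
Solution-reflect : ∀ {a' y y₁ b' c' P Q} → y + y₁ ≡ a' → b' + c' ≡ 2 * a' →
  Solution (suc a') (suc b') y P Q → Solution (suc a') (suc c') y₁ (P + 2 * y) (Q + a')
Solution-reflect {y = y} {y₁} {b'} {c'} {P} {Q} refl b'+c'≡2a' (solution s) =
  solution (+-cancelʳ-≡ (SR + T) L R (begin
    L + (SR + T)                                 ≡⟨ cong (λ u → L + (SR + (y * u + y₁ * (2 * a')))) b'+c'≡2a' ⟨
    L + (SR + (y * (b' + c') + y₁ * (2 * a')))   ≡⟨ regroup y y₁ b' c' P Q ⟩
    R + (SL + (y₁ * (b' + c') + y * (2 * a')))   ≡⟨ cong₂ (λ u v → R + (u + (y₁ * v + y * (2 * a')))) s b'+c'≡2a' ⟩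
    R + (SR + (y₁ * (2 * a') + y * (2 * a')))    ≡⟨ cong (λ u → R + (SR + u)) (+-comm (y₁ * (2 * a')) _) ⟩
    R + (SR + T)                                 ∎))
  where
  open ≡-Reasoning
  a' a L R SL SR T : ℕ
  a' = y + y₁
  a = suc a'
  L = 2 * (suc c' * y₁) + 2 * (a * (P + 2 * y))
  R = a' * c' + 2 * (a * (Q + a'))
  SL = 2 * (suc b' * y) + 2 * (a * P)
  SR = a' * b' + 2 * (a * Q)
  T = y * (2 * a') + y₁ * (2 * a')
  regroup : ∀ y y₁ b' c' P Q →
      (2 * (suc c' * y₁) + 2 * (suc (y + y₁) * (P + 2 * y)))
        + (((y + y₁) * b' + 2 * (suc (y + y₁) * Q)) + (y * (b' + c') + y₁ * (2 * (y + y₁))))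
    ≡ ((y + y₁) * c' + 2 * (suc (y + y₁) * (Q + (y + y₁))))
        + ((2 * (suc b' * y) + 2 * (suc (y + y₁) * P)) + (y₁ * (b' + c') + y * (2 * (y + y₁))))
  regroup = solve-∀

2*m+2*n≡k+k : ∀ m n {k} → m + n ≡ k → 2 * m + 2 * n ≡ k + k
2*m+2*n≡k+k m n refl = regroup m n
  where
  regroup : ∀ m n → 2 * m + 2 * n ≡ (m + n) + (m + n)
  regroup = solve-∀

¬[2m<k×2n<k] : ∀ m n {k} → m + n ≡ k → 2 * m < k → 2 * n < k → ⊥
¬[2m<k×2n<k] m n m+n≡k 2m<k 2n<k = <-irrefl (2*m+2*n≡k+k m n m+n≡k) (+-mono-< 2m<k 2n<k)

¬[k<2m×k<2n] : ∀ m n {k} → m + n ≡ k → k < 2 * m → k < 2 * n → ⊥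
¬[k<2m×k<2n] m n m+n≡k k<2m k<2n = <-irrefl (sym (2*m+2*n≡k+k m n m+n≡k)) (+-mono-< k<2m k<2n)

Γᶜ-reflect : ∀ {a' b' c'} → 1 ≤ a' → b' + c' ≡ 2 * a' →
  Coprime (suc a') (suc b') → Coprime (suc a') (suc c') → Γᶜ (suc a') (suc b') ≢ Γᶜ (suc a') (suc c')
Γᶜ-reflect {a'} {b'} {c'} 1≤a' b'+c'≡2a' cop-b cop-c =
  let y , y<a , P , Q , s = solution-exists cop-b
      y₁ , y+y₁≡a' = m≤n⇒∃[o]m+o≡n (≤-pred y<a)
  in compare y+y₁≡a' y<a s (Solution-reflect y+y₁≡a' b'+c'≡2a' s)
       (≤-<-connex Q P) (≤-<-connex (Q + a') (P + 2 * y))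
  where
  1≢2 : 1 ≢ 2
  1≢2 ()
  compare : ∀ {y y₁ P Q} → y + y₁ ≡ a' → y < suc a' →
            Solution (suc a') (suc b') y P Q → Solution (suc a') (suc c') y₁ (P + 2 * y) (Q + a') →
            Q ≤ P ⊎ P < Q → Q + a' ≤ P + 2 * y ⊎ P + 2 * y < Q + a' →
            Γᶜ (suc a') (suc b') ≢ Γᶜ (suc a') (suc c')
  compare {y} {y₁} y+y₁≡a' _ s s' (inj₁ Q≤P) (inj₁ Q'≤P') _ = ¬[2m<k×2n<k] y y₁ y+y₁≡a'
    (E1At⇒2y<a' 1≤a' (Solution⇒E1At s Q≤P)) (E1At⇒2y<a' 1≤a' (Solution⇒E1At s' Q'≤P'))
  compare {y} {y₁} y+y₁≡a' _ s s' (inj₁ Q≤P) (inj₂ P'<Q') Γ≡ =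
    1≢2 (trans (sym (Solution⇒Γᶜ≡1 cop-b s Q≤P)) (trans Γ≡ (Solution⇒Γᶜ≡2 cop-c y₁<a s' P'<Q')))
    where
    y₁<a : y₁ < suc a'
    y₁<a = s≤s (subst (y₁ ≤_) y+y₁≡a' (m≤n+m y₁ y))
  compare _ y<a s s' (inj₂ P<Q) (inj₁ Q'≤P') Γ≡ =
    1≢2 (trans (sym (Solution⇒Γᶜ≡1 cop-c s' Q'≤P')) (trans (sym Γ≡) (Solution⇒Γᶜ≡2 cop-b y<a s P<Q)))
  compare {y} {y₁} y+y₁≡a' _ s s' (inj₂ P<Q) (inj₂ P'<Q') _ = ¬[k<2m×k<2n] y y₁ y+y₁≡a'
    (AboveAt⇒a'<2y (Solution⇒AboveAt s P<Q)) (AboveAt⇒a'<2y (Solution⇒AboveAt s' P'<Q'))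

UsesE1-1ˡ : ∀ b → UsesE1 1 b
UsesE1-1ˡ b = 0 , 0 , *-zeroʳ b

Γᶜ-1ˡ : ∀ b → Γᶜ 1 b ≡ 1
Γᶜ-1ˡ b = Γᶜ≡1 {1} {b} (UsesE1-1ˡ b)

UsesE1-1ʳ : ∀ a → UsesE1 a 1
UsesE1-1ʳ a = 0 , 0 , trans (cong (_+ 0) (*-zeroʳ a)) (sym (cong (_/ 2) (*-zeroʳ (a ∸ 1))))

Γᶜ-1ʳ : ∀ a → Γᶜ a 1 ≡ 1
Γᶜ-1ʳ a = Γᶜ≡1 {a} {1} (UsesE1-1ʳ a)

Coprime-suc : ∀ n → Coprime n (suc n)
Coprime-suc n = subst (Coprime n) (+-comm n 1) (Coprimality.sym (coprime-+ (1-coprimeTo n)))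

Γᶜ-even-suc : ∀ h → Γᶜ (suc (suc (2 * h))) (suc (suc (suc (2 * h)))) ≡ 2
Γᶜ-even-suc h = Solution⇒Γᶜ≡2 {P = 0} {Q = 1} (Coprime-suc a) y<a (solution (equation h)) (s≤s z≤n)
  where
  a : ℕ
  a = suc (suc (2 * h))
  y<a : suc h < a
  y<a = s≤s (s≤s (m≤m+n h (h + 0)))
  equation : ∀ h → 2 * (suc (suc (suc (2 * h))) * suc h) + 2 * (suc (suc (2 * h)) * 0)
               ≡ suc (2 * h) * suc (suc (2 * h)) + 2 * (suc (suc (2 * h)) * 1)
  equation = solve-∀

-- Reduction of Γ to coprime pairs

gcd[cm,cn]≡c : ∀ c {m n} → Coprime m n → gcd (c * m) (c * n) ≡ c
gcd[cm,cn]≡c c {m} {n} cop = begin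
  gcd (c * m) (c * n)   ≡⟨ c*gcd[m,n]≡gcd[cm,cn] c m n ⟨
  c * gcd m n           ≡⟨ cong (c *_) (coprime⇒gcd≡1 cop) ⟩
  c * 1                 ≡⟨ *-identityʳ c ⟩
  c                     ∎
  where open ≡-Reasoning

opaque
  unfolding Γᶜ

  Γ-unfold : ∀ k n {d} → gcd k n ≡ suc d → Γ k n ≡ Γᶜ (k / suc d) (n / suc d)
  Γ-unfold k n g≡ rewrite g≡ = refl

Γ-reduce : ∀ d {a b} → Coprime a b → Γ (suc d * a) (suc d * b) ≡ Γᶜ a b
Γ-reduce d {a} {b} cop =
  trans (Γ-unfold (suc d * a) (suc d * b) (gcd[cm,cn]≡c (suc d) cop)) (cong₂ Γᶜ (cancel a) (cancel b))
  where
  cancel : ∀ x → (suc d * x) / suc d ≡ x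
  cancel x = trans (cong (_/ suc d) (*-comm (suc d) x)) (m*n/n≡m x (suc d))

coprime-factorisation : ∀ {k n} → 1 ≤ k → 1 ≤ n →
  ∃ λ d → ∃₂ λ a' b' → k ≡ suc d * suc a' × n ≡ suc d * suc b' × Coprime (suc a') (suc b')
coprime-factorisation {suc k'} {n} 1≤k 1≤n
  with gcd (suc k') n | gcd[m,n]∣m (suc k') n | gcd[m,n]∣n (suc k') n
     | coprime-/gcd (suc k') n {{≢-nonZero (gcd[m,n]≢0 (suc k') n (inj₁ λ ()))}}
... | zero | 0∣k | _ | _ = ⊥-elim (1+n≢0 (0∣⇒≡0 0∣k))
... | suc d | g∣k | g∣n | cop = positive (sym (m*[n/m]≡n g∣k)) (sym (m*[n/m]≡n g∣n)) cop
  where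
  positive : ∀ {a b} → suc k' ≡ suc d * a → n ≡ suc d * b → Coprime a b →
    ∃ λ d → ∃₂ λ a' b' → suc k' ≡ suc d * suc a' × n ≡ suc d * suc b' × Coprime (suc a') (suc b')
  positive {zero} k≡ _ _ = ⊥-elim (1+n≢0 (trans k≡ (*-zeroʳ (suc d))))
  positive {suc a'} {zero} _ refl _ = ⊥-elim (n≮0 (subst (1 ≤_) (*-zeroʳ (suc d)) 1≤n))
  positive {suc a'} {suc b'} k≡ n≡ cop = d , a' , b' , k≡ , n≡ , cop

Γ-+-2k : ∀ {k n} → 1 ≤ k → 1 ≤ n → Γ k (n + 2 * k) ≡ Γ k n
Γ-+-2k 1≤k 1≤n with coprime-factorisation 1≤k 1≤n
... | d , a' , b' , refl , refl , cop = begin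
  Γ (e * a) (e * b + 2 * (e * a))   ≡⟨ cong (Γ (e * a)) (regroup e a b) ⟩
  Γ (e * a) (e * (b + 2 * a))       ≡⟨ Γ-reduce d (Coprime-+-* 2 cop) ⟩
  Γᶜ a (b + 2 * a)                  ≡⟨ Γᶜ-+-* 2 a' (s≤s z≤n) refl cop ⟩
  Γᶜ a b                            ≡⟨ Γ-reduce d cop ⟨
  Γ (e * a) (e * b)                 ∎
  where
  open ≡-Reasoning
  e a b : ℕ
  e = suc d
  a = suc a'
  b = suc b'
  regroup : ∀ e a b → e * b + 2 * (e * a) ≡ e * (b + 2 * a)
  regroup = solve-∀

Γ-+-k : ∀ {k n} m → k ≡ suc (2 * m) → 1 ≤ n → Γ k (n + k) ≡ Γ k n
Γ-+-k m k≡ 1≤n with coprime-factorisation (subst (1 ≤_) (sym k≡) (s≤s z≤n)) 1≤n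
... | d , a' , b' , refl , refl , cop with even⊎odd a'
... | inj₂ (h , refl) = ⊥-elim (even≢odd (suc d * suc h) m (trans (regroup d h) k≡))
  where
  regroup : ∀ d h → 2 * (suc d * suc h) ≡ suc d * suc (suc (2 * h))
  regroup = solve-∀
... | inj₁ (h , refl) = begin
  Γ (e * a) (e * b + e * a)   ≡⟨ cong (Γ (e * a)) (regroup e a b) ⟩
  Γ (e * a) (e * (b + 1 * a)) ≡⟨ Γ-reduce d (Coprime-+-* 1 cop) ⟩
  Γᶜ a (b + 1 * a)            ≡⟨ Γᶜ-+-* 1 h (s≤s z≤n) (sym (*-identityˡ (2 * h))) cop ⟩
  Γᶜ a b                      ≡⟨ Γ-reduce d cop ⟨
  Γ (e * a) (e * b)           ∎
  where
  open ≡-Reasoning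
  e a b : ℕ
  e = suc d
  a = suc (2 * h)
  b = suc b'
  regroup : ∀ e a b → e * b + e * a ≡ e * (b + 1 * a)
  regroup = solve-∀

Coprime-reflect : ∀ {a b c} → c + b ≡ 2 * a → Coprime a b → Coprime a c
Coprime-reflect {a} c+b≡2a cop {i} (i∣a , i∣c) =
  cop (i∣a , ∣m+n∣m⇒∣n (subst (i ∣_) (sym c+b≡2a) (∣-trans i∣a (n∣m*n 2))) i∣c)

2*[e*c]∸e*b≡e*a : ∀ {a b c} e → a + b ≡ 2 * c → 2 * (e * c) ∸ e * b ≡ e * a
2*[e*c]∸e*b≡e*a {a} {b} {c} e a+b≡2c = begin
  2 * (e * c) ∸ e * b       ≡⟨ cong (_∸ e * b) (2*[m*n]≡m*[2*n] e c) ⟩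
  e * (2 * c) ∸ e * b       ≡⟨ cong (λ t → e * t ∸ e * b) a+b≡2c ⟨
  e * (a + b) ∸ e * b       ≡⟨ cong (_∸ e * b) (*-distribˡ-+ e a b) ⟩
  e * a + e * b ∸ e * b     ≡⟨ m+n∸n≡m (e * a) (e * b) ⟩
  e * a                     ∎
  where open ≡-Reasoning

Γ-reflect-scaled : ∀ d a' b' c' → suc c' + suc b' ≡ 2 * suc a' → suc b' ≢ suc a' → Coprime (suc a') (suc b') →
  Γ (suc d * suc a') (suc d * suc b') ≢ Γ (suc d * suc a') (suc d * suc c')
Γ-reflect-scaled d zero b' c' c+b≡2 b≢a _ _ =
  b≢a (cong suc (m+n≡0⇒n≡0 c' (suc-injective (trans (sym (+-suc c' b')) (suc-injective c+b≡2)))))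
Γ-reflect-scaled d (suc a'') b' c' c+b≡2a _ cop Γ≡ =
  Γᶜ-reflect (s≤s z≤n) b'+c'≡2a' cop cop-c (begin
    Γᶜ a (suc b')                  ≡⟨ Γ-reduce d cop ⟨
    Γ (suc d * a) (suc d * suc b') ≡⟨ Γ≡ ⟩
    Γ (suc d * a) (suc d * suc c') ≡⟨ Γ-reduce d cop-c ⟩
    Γᶜ a (suc c')                  ∎)
  where
  open ≡-Reasoning
  a : ℕ
  a = suc (suc a'')
  cop-c : Coprime a (suc c')
  cop-c = Coprime-reflect c+b≡2a cop
  b'+c'≡2a' : b' + c' ≡ 2 * suc a''
  b'+c'≡2a' = suc-injective (suc-injective (trans (regroup b' c') (trans c+b≡2a (regroup′ a''))))
    where
    regroup : ∀ b' c' → suc (suc (b' + c')) ≡ suc c' + suc b'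
    regroup = solve-∀
    regroup′ : ∀ a'' → 2 * suc (suc a'') ≡ suc (suc (2 * suc a''))
    regroup′ = solve-∀

n<2k⇒1≤k : ∀ k {n} → n < 2 * k → 1 ≤ k
n<2k⇒1≤k (suc k) _ = s≤s z≤n

Γ-reflect : ∀ {k n} → 1 ≤ n → n < 2 * k → n ≢ k → Γ k n ≢ Γ k (2 * k ∸ n)
Γ-reflect {k} {n} 1≤n n<2k n≢k with coprime-factorisation (n<2k⇒1≤k k n<2k) 1≤n
... | d , a' , b' , refl , refl , cop =
  let c' , b+c≡2a = m≤n⇒∃[o]m+o≡n b<2a
      c+b≡2a = trans (+-comm (suc c') (suc b')) (trans (+-suc (suc b') c') b+c≡2a)
  in λ Γ≡ → Γ-reflect-scaled d a' b' c' c+b≡2a (n≢k ∘ cong (suc d *_)) cop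
              (trans Γ≡ (cong (Γ (suc d * suc a'))
                              (2*[e*c]∸e*b≡e*a {suc c'} {suc b'} {suc a'} (suc d) c+b≡2a)))
  where
  b<2a : suc b' < 2 * suc a'
  b<2a = *-cancelˡ-< (suc d) _ _ (subst (suc d * suc b' <_) (2*[m*n]≡m*[2*n] (suc d) (suc a')) n<2k)

Γ-* : ∀ k m → 1 ≤ k → Γ k (k * m) ≡ 1
Γ-* (suc d) m _ = begin
  Γ (suc d) (suc d * m)       ≡⟨ cong (λ t → Γ t (suc d * m)) (*-identityʳ (suc d)) ⟨
  Γ (suc d * 1) (suc d * m)   ≡⟨ Γ-reduce d (1-coprimeTo m) ⟩
  Γᶜ 1 m                      ≡⟨ Γᶜ-1ˡ m ⟩
  1                           ∎
  where open ≡-Reasoning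

Γ-1 : ∀ k → Γ k 1 ≡ 1
Γ-1 k = begin
  Γ k 1               ≡⟨ cong (λ t → Γ t 1) (*-identityˡ k) ⟨
  Γ (1 * k) (1 * 1)   ≡⟨ Γ-reduce 0 (Coprimality.sym (1-coprimeTo k)) ⟩
  Γᶜ k 1              ≡⟨ Γᶜ-1ʳ k ⟩
  1                   ∎
  where open ≡-Reasoning

Γ-even-suc : ∀ {k} m → k ≡ 2 * m → 1 ≤ k → Γ k (suc k) ≡ 2
Γ-even-suc zero refl ()
Γ-even-suc (suc h) refl _ = subst (λ k → Γ k (suc k) ≡ 2) (sym (regroup h)) (begin
  Γ a (suc a)               ≡⟨ cong₂ Γ (*-identityˡ a) (*-identityˡ (suc a)) ⟨
  Γ (1 * a) (1 * suc a)     ≡⟨ Γ-reduce 0 (Coprime-suc a) ⟩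
  Γᶜ a (suc a)              ≡⟨ Γᶜ-even-suc h ⟩
  2                         ∎)
  where
  open ≡-Reasoning
  a : ℕ
  a = suc (suc (2 * h))
  regroup : ∀ h → 2 * suc h ≡ suc (suc (2 * h))
  regroup = solve-∀

Γ≡1⊎Γ≡2 : ∀ k n → Γ k n ≡ 1 ⊎ Γ k n ≡ 2
Γ≡1⊎Γ≡2 k n with gcd k n
... | zero = inj₂ refl
... | suc d with does (usesE1? (k / suc d) (n / suc d))
... | true = inj₁ refl
... | false = inj₂ refl

-- Periods

IsPeriod-* : ∀ {f T} → IsPeriod f T → ∀ j {n} → 1 ≤ n → f n ≡ f (n + j * T)
IsPeriod-* {f} _ zero {n} _ = cong f (sym (+-identityʳ n))
IsPeriod-* {f} {T} per@(_ , f≡f[+T]) (suc j) {n} 1≤n = begin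
  f n                  ≡⟨ IsPeriod-* per j 1≤n ⟩
  f (n + j * T)        ≡⟨ f≡f[+T] (n + j * T) (≤-trans 1≤n (m≤m+n n (j * T))) ⟩
  f (n + j * T + T)    ≡⟨ cong f (regroup n j T) ⟩
  f (n + suc j * T)    ∎
  where
  open ≡-Reasoning
  regroup : ∀ n j T → n + j * T + T ≡ n + suc j * T
  regroup = solve-∀

k∸n+k≡2k∸n : ∀ {k n} → n ≤ k → k ∸ n + k ≡ 2 * k ∸ n
k∸n+k≡2k∸n {k} {n} n≤k = begin
  k ∸ n + k        ≡⟨ +-∸-comm k n≤k ⟨
  k + k ∸ n        ≡⟨ cong (λ t → k + t ∸ n) (+-identityʳ k) ⟨
  2 * k ∸ n        ∎
  where open ≡-Reasoning

period-below-2k≡k : ∀ k {T} → IsPeriod (Γ k) T → T < 2 * k → T ≡ k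
period-below-2k≡k zero _ ()
period-below-2k≡k k@(suc k') {T} per@(1≤T , Γ≡Γ[+T]) T<2k with T ≟ k
... | yes T≡k = T≡k
... | no T≢k = ⊥-elim (Γ-reflect 1≤T T<2k T≢k (trans ΓT≡1 (sym Γ[2k∸T]≡1)))
  where
  open ≡-Reasoning
  ΓT≡1 : Γ k T ≡ 1
  ΓT≡1 = begin
    Γ k T                       ≡⟨ IsPeriod-* per (suc (2 * k')) 1≤T ⟩
    Γ k (T + suc (2 * k') * T)  ≡⟨ cong (Γ k) (regroup k' T) ⟩
    Γ k (k * (2 * T))           ≡⟨ Γ-* k (2 * T) (s≤s z≤n) ⟩
    1                           ∎
    where
    regroup : ∀ k' T → T + suc (2 * k') * T ≡ suc k' * (2 * T)
    regroup = solve-∀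
  Γ[2k∸T]≡1 : Γ k (2 * k ∸ T) ≡ 1
  Γ[2k∸T]≡1 = begin
    Γ k (2 * k ∸ T)             ≡⟨ Γ≡Γ[+T] (2 * k ∸ T) (m<n⇒0<n∸m T<2k) ⟩
    Γ k (2 * k ∸ T + T)         ≡⟨ cong (Γ k) (m∸n+n≡m (<⇒≤ T<2k)) ⟩
    Γ k (2 * k)                 ≡⟨ cong (Γ k) (*-comm 2 k) ⟩
    Γ k (k * 2)                 ≡⟨ Γ-* k 2 (s≤s z≤n) ⟩
    1                           ∎

Γ-period-odd : ∀ {k} m → k ≡ suc (2 * m) → HasPeriod (λ n → Γ k n) k
Γ-period-odd {k} m k≡ = (1≤k , λ n 1≤n → sym (Γ-+-k m k≡ 1≤n)) , minimal
  where
  1≤k : 1 ≤ k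
  1≤k = subst (1 ≤_) (sym k≡) (s≤s z≤n)
  minimal : ∀ T → IsPeriod (λ n → Γ k n) T → k ≤ T
  minimal T per with k ≤? T
  ... | yes k≤T = k≤T
  ... | no k≰T = ⊥-elim (<-irrefl (period-below-2k≡k k per (≤-trans T<k (m≤m+n k (k + 0)))) T<k)
    where
    T<k : T < k
    T<k = ≰⇒> k≰T

Γ-period-even : ∀ {k} m → k ≡ 2 * m → 1 ≤ k → HasPeriod (λ n → Γ k n) (2 * k)
Γ-period-even {k} m k≡ 1≤k = (≤-trans 1≤k (m≤m+n k (k + 0)) , λ n 1≤n → sym (Γ-+-2k 1≤k 1≤n)) , minimal
  where
  1≢2 : 1 ≢ 2
  1≢2 ()
  minimal : ∀ T → IsPeriod (λ n → Γ k n) T → 2 * k ≤ T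
  minimal T per@(_ , Γ≡Γ[+T]) with 2 * k ≤? T
  ... | yes 2k≤T = 2k≤T
  ... | no 2k≰T with period-below-2k≡k k per (≰⇒> 2k≰T)
  ...   | refl = ⊥-elim (1≢2 (begin
    1              ≡⟨ Γ-1 k ⟨
    Γ k 1          ≡⟨ Γ≡Γ[+T] 1 (s≤s z≤n) ⟩
    Γ k (suc k)    ≡⟨ Γ-even-suc m k≡ 1≤k ⟩
    2              ∎))
    where open ≡-Reasoning

-- Counting

indicator : ℕ → ℕ → ℕ
indicator x v = if does (x ≟ v) then 1 else 0

indicator-swap : ∀ {x y} → x ≡ 1 ⊎ x ≡ 2 → y ≡ 1 ⊎ y ≡ 2 → x ≢ y →
  indicator y 1 ≡ indicator x 2 × indicator y 2 ≡ indicator x 1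
indicator-swap (inj₁ refl) (inj₁ refl) x≢y = ⊥-elim (x≢y refl)
indicator-swap (inj₁ refl) (inj₂ refl) _   = refl , refl
indicator-swap (inj₂ refl) (inj₁ refl) _   = refl , refl
indicator-swap (inj₂ refl) (inj₂ refl) x≢y = ⊥-elim (x≢y refl)

sum< : (ℕ → ℕ) → ℕ → ℕ
sum< φ zero = 0
sum< φ (suc m) = φ 0 + sum< (φ ∘ suc) m

length-filter-applyUpTo : ∀ (f : ℕ → ℕ) v (g : ℕ → ℕ) m →
  length (filter (λ i → f i ≟ v) (applyUpTo g m)) ≡ sum< (λ i → indicator (f (g i)) v) m
length-filter-applyUpTo f v g zero = refl
length-filter-applyUpTo f v g (suc m) with f (g 0) ≡ᵇ v
... | true  = cong suc (length-filter-applyUpTo f v (g ∘ suc) m)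
... | false = length-filter-applyUpTo f v (g ∘ suc) m

sum<-cong : ∀ {φ ψ} m → (∀ i → i < m → φ i ≡ ψ i) → sum< φ m ≡ sum< ψ m
sum<-cong zero _ = refl
sum<-cong (suc m) φ≡ψ = cong₂ _+_ (φ≡ψ 0 z<s) (sum<-cong m (λ i i<m → φ≡ψ (suc i) (s<s i<m)))

sum<-suc : ∀ φ m → sum< φ (suc m) ≡ sum< φ m + φ m
sum<-suc φ zero = +-comm (φ 0) 0
sum<-suc φ (suc m) = trans (cong (φ 0 +_) (sum<-suc (φ ∘ suc) m)) (sym (+-assoc (φ 0) _ _))

sum<-+ : ∀ φ m n → sum< φ (m + n) ≡ sum< φ m + sum< (λ i → φ (m + i)) n
sum<-+ φ zero n = refl
sum<-+ φ (suc m) n = trans (cong (φ 0 +_) (sum<-+ (φ ∘ suc) m n)) (sym (+-assoc (φ 0) _ _))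

sum<-reverse : ∀ φ m → sum< φ m ≡ sum< (λ i → φ (m ∸ suc i)) m
sum<-reverse φ zero = refl
sum<-reverse φ (suc m) = begin
  sum< φ (suc m)                                ≡⟨ sum<-suc φ m ⟩
  sum< φ m + φ m                                ≡⟨ cong (_+ φ m) (sum<-reverse φ m) ⟩
  sum< (λ i → φ (m ∸ suc i)) m + φ m            ≡⟨ +-comm _ (φ m) ⟩
  φ m + sum< (λ i → φ (m ∸ suc i)) m            ∎
  where open ≡-Reasoning

sum<-reflect : ∀ {φ ψ} m → (∀ i → i < m → ψ (m ∸ suc i) ≡ φ i) → sum< ψ m ≡ sum< φ m
sum<-reflect {φ} {ψ} m ψ≡φ = trans (sum<-reverse ψ m) (sum<-cong m ψ≡φ)

countVal-suc : ∀ f v m →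
  countVal f v (suc m) ≡ sum< (λ i → indicator (f (suc i)) v) m + indicator (f (suc m)) v
countVal-suc f v m =
  trans (length-filter-applyUpTo f v suc (suc m)) (sum<-suc (λ i → indicator (f (suc i)) v) m)

Γ-reflect-indicator : ∀ {k n} → 1 ≤ n → n < 2 * k → n ≢ k →
  indicator (Γ k (2 * k ∸ n)) 1 ≡ indicator (Γ k n) 2 ×
  indicator (Γ k (2 * k ∸ n)) 2 ≡ indicator (Γ k n) 1
Γ-reflect-indicator {k} {n} 1≤n n<2k n≢k =
  indicator-swap (Γ≡1⊎Γ≡2 k n) (Γ≡1⊎Γ≡2 k (2 * k ∸ n)) (Γ-reflect 1≤n n<2k n≢k)

Γ-k : ∀ k → 1 ≤ k → Γ k k ≡ 1
Γ-k k 1≤k = trans (cong (Γ k) (sym (*-identityʳ k))) (Γ-* k 1 1≤k)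

Γ-count-odd : ∀ {k} m → k ≡ suc (2 * m) → countVal (λ n → Γ k n) 1 k ≡ 1 + countVal (λ n → Γ k n) 2 k
Γ-count-odd m refl = begin
  countVal f 1 k                       ≡⟨ countVal-suc f 1 K' ⟩
  sum< (φ 1) K' + indicator (f k) 1    ≡⟨ cong₂ (λ s t → s + indicator t 1) (sum<-reflect K' reflect) Γkk≡1 ⟩
  sum< (φ 2) K' + 1                    ≡⟨ +-comm _ 1 ⟩
  1 + sum< (φ 2) K'                    ≡⟨ cong (1 +_) (+-identityʳ _) ⟨
  1 + (sum< (φ 2) K' + 0)              ≡⟨ cong (λ t → 1 + (sum< (φ 2) K' + indicator t 2)) Γkk≡1 ⟨
  1 + (sum< (φ 2) K' + indicator (f k) 2) ≡⟨ cong (1 +_) (countVal-suc f 2 K') ⟨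
  1 + countVal f 2 k                   ∎
  where
  open ≡-Reasoning
  K' k : ℕ
  K' = 2 * m
  k = suc K'
  f : ℕ → ℕ
  f n = Γ k n
  φ : ℕ → ℕ → ℕ
  φ v i = indicator (f (suc i)) v
  Γkk≡1 : f k ≡ 1
  Γkk≡1 = Γ-k k (s≤s z≤n)
  reflect : ∀ i → i < K' → φ 1 (K' ∸ suc i) ≡ φ 2 i
  reflect i i<K' = begin
    indicator (f (suc (K' ∸ suc i))) 1     ≡⟨ cong (λ t → indicator (f t) 1) (+-∸-assoc 1 i<K') ⟨
    indicator (f (k ∸ suc i)) 1            ≡⟨ cong (λ t → indicator t 1) (Γ-+-k m refl 1≤k∸n) ⟨
    indicator (f (k ∸ suc i + k)) 1        ≡⟨ cong (λ t → indicator (f t) 1) (k∸n+k≡2k∸n (<⇒≤ n<k)) ⟩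
    indicator (f (2 * k ∸ suc i)) 1        ≡⟨ proj₁ (Γ-reflect-indicator (s≤s z≤n) n<2k n≢k) ⟩
    indicator (f (suc i)) 2                ∎
    where
    n<k : suc i < k
    n<k = s≤s i<K'
    n<2k : suc i < 2 * k
    n<2k = ≤-trans n<k (m≤m+n k (k + 0))
    n≢k : suc i ≢ k
    n≢k = <⇒≢ n<k
    1≤k∸n : 1 ≤ k ∸ suc i
    1≤k∸n = m<n⇒0<n∸m n<k

Γ-count-2k : ∀ k → 1 ≤ k → countVal (λ n → Γ k n) 1 (2 * k) ≡ 2 + countVal (λ n → Γ k n) 2 (2 * k)
Γ-count-2k k@(suc K') _ = begin
  countVal f 1 (2 * k)                               ≡⟨ halves 1 ⟩
  (sum< (φ 1) K' + 1) + (sum< (ψ 1) K' + 1)          ≡⟨ cong (λ t → (sum< (φ 1) K' + 1) + (t + 1)) ψ₁≡φ₂ ⟩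
  (sum< (φ 1) K' + 1) + (sum< (φ 2) K' + 1)          ≡⟨ regroup (sum< (φ 1) K') (sum< (φ 2) K') ⟩
  2 + ((sum< (φ 2) K' + 0) + (sum< (φ 1) K' + 0))    ≡⟨ cong (λ t → 2 + ((sum< (φ 2) K' + 0) + (t + 0))) ψ₂≡φ₁ ⟨
  2 + ((sum< (φ 2) K' + 0) + (sum< (ψ 2) K' + 0))    ≡⟨ cong (2 +_) (halves 2) ⟨
  2 + countVal f 2 (2 * k)                           ∎
  where
  open ≡-Reasoning
  f : ℕ → ℕ
  f n = Γ k n
  φ ψ : ℕ → ℕ → ℕ
  φ v i = indicator (f (suc i)) v
  ψ v i = φ v (k + i)
  regroup : ∀ x y → (x + 1) + (y + 1) ≡ 2 + ((y + 0) + (x + 0))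
  regroup = solve-∀
  1+[k+K']≡2k : suc (k + K') ≡ 2 * k
  1+[k+K']≡2k = trans (sym (+-suc k K')) (cong (k +_) (sym (+-identityʳ k)))
  halves : ∀ v → countVal f v (2 * k) ≡ (sum< (φ v) K' + indicator 1 v) + (sum< (ψ v) K' + indicator 1 v)
  halves v = begin
    countVal f v (2 * k)                                ≡⟨ length-filter-applyUpTo f v suc (2 * k) ⟩
    sum< (φ v) (2 * k)                                  ≡⟨ cong (λ t → sum< (φ v) (k + t)) (+-identityʳ k) ⟩
    sum< (φ v) (k + k)                                  ≡⟨ sum<-+ (φ v) k k ⟩
    sum< (φ v) k + sum< (ψ v) k                         ≡⟨ cong₂ _+_ (sum<-suc (φ v) K') (sum<-suc (ψ v) K') ⟩
    (sum< (φ v) K' + indicator (f k) v) + (sum< (ψ v) K' + indicator (f (suc (k + K'))) v)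
      ≡⟨ cong₂ (λ s t → (sum< (φ v) K' + indicator s v) + (sum< (ψ v) K' + indicator t v))
               (Γ-k k (s≤s z≤n)) Γ[1+k+K']≡1 ⟩
    (sum< (φ v) K' + indicator 1 v) + (sum< (ψ v) K' + indicator 1 v) ∎
    where
    Γ[1+k+K']≡1 : f (suc (k + K')) ≡ 1
    Γ[1+k+K']≡1 = trans (cong f (trans 1+[k+K']≡2k (*-comm 2 k))) (Γ-* k 2 (s≤s z≤n))
  reflected : ∀ v w → (∀ {n} → 1 ≤ n → n < 2 * k → n ≢ k → indicator (f (2 * k ∸ n)) v ≡ indicator (f n) w) →
              sum< (ψ v) K' ≡ sum< (φ w) K'
  reflected v w f[2k∸n]≈f[n] = sum<-reflect K' λ i i<K' → begin
    indicator (f (suc (k + (K' ∸ suc i)))) v   ≡⟨ cong (λ t → indicator (f t) v) (index i<K') ⟩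
    indicator (f (2 * k ∸ suc i)) v            ≡⟨ f[2k∸n]≈f[n] (s≤s z≤n) (n<2k i<K') (<⇒≢ (s≤s i<K')) ⟩
    indicator (f (suc i)) w                    ∎
    where
    n<2k : ∀ {i} → i < K' → suc i < 2 * k
    n<2k i<K' = ≤-trans (s≤s i<K') (m≤m+n k (k + 0))
    index : ∀ {i} → i < K' → suc (k + (K' ∸ suc i)) ≡ 2 * k ∸ suc i
    index {i} i<K' = begin
      suc (k + (K' ∸ suc i))    ≡⟨ +-suc k (K' ∸ suc i) ⟨
      k + suc (K' ∸ suc i)      ≡⟨ cong (k +_) (+-∸-assoc 1 i<K') ⟨
      k + (k ∸ suc i)           ≡⟨ +-comm k (k ∸ suc i) ⟩
      k ∸ suc i + k             ≡⟨ k∸n+k≡2k∸n (<⇒≤ (s≤s i<K')) ⟩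
      2 * k ∸ suc i             ∎
  ψ₁≡φ₂ : sum< (ψ 1) K' ≡ sum< (φ 2) K'
  ψ₁≡φ₂ = reflected 1 2 λ 1≤n n<2k n≢k → proj₁ (Γ-reflect-indicator 1≤n n<2k n≢k)
  ψ₂≡φ₁ : sum< (ψ 2) K' ≡ sum< (φ 1) K'
  ψ₂≡φ₁ = reflected 2 1 λ 1≤n n<2k n≢k → proj₂ (Γ-reflect-indicator 1≤n n<2k n≢k)


theorem1p6 : (k : ℕ) → 1 ≤ k →
    ((∃ λ m → k ≡ suc (2 * m)) →
      HasPeriod (λ n → Γ k n) k ×
      countVal (λ n → Γ k n) 1 k ≡ 1 + countVal (λ n → Γ k n) 2 k)
    × ((∃ λ m → k ≡ 2 * m) →
      HasPeriod (λ n → Γ k n) (2 * k) ×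
      countVal (λ n → Γ k n) 1 (2 * k) ≡ 2 + countVal (λ n → Γ k n) 2 (2 * k))
theorem1p6 k 1≤k =
  (λ (m , k≡1+2m) → Γ-period-odd m k≡1+2m , Γ-count-odd m k≡1+2m) ,
  (λ (m , k≡2m) → Γ-period-even m k≡2m 1≤k , Γ-count-2k k 1≤k)
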